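{- Let $r\geq 2$ and $n\geq 1$ be integers and fix an $r$-coloring of the edges of $K_n$, with $\mathcal{C}$ the set of all monochromatic components. Let $z\in\mathbb{R}^+$. If there exists a set of components $\mathcal{X}\subseteq\mathcal{C}$ such that, for some positive integer $x$ and some $\gamma\in[0,r]$, we have $|\mathcal{X}|=x$, $\sum_{C\in\mathcal{X}}|V(C)|\geq\gamma n$, and \[ x\leq \frac{1}{z}-\frac{r-\gamma}{\sqrt{z}}, \] then there is a component $C\in\mathcal{C}$ with at least $z\binom{n}{2}$ edges.
   Context: For an $r$-coloring of the edges of $K_n$ with colors $1,\dots,r$, let $G_i$ be the spanning subgraph on all $n$ vertices consisting of the edges of color $i$. The monochromatic components are the connected components of the graphs $G_i$ (isolated vertices included), and $\mathcal{C}$ is the set of all of them over all colors, components of different colors being regarded as distinct elements. $V(C)$, $E(C)$ denote the vertex and edge sets of $C$.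
   Formalization: The parameters z and γ range over the rationals rather than the reals. -}

module Defs where

open import Data.Nat using (ℕ; zero; suc; _<_)
open import Data.Nat.Properties using (_<?_)
open import Data.Fin using (Fin; toℕ)
open import Data.Fin.Subset using (Subset; _∈_)
open import Data.Fin.Subset.Properties using (_∈?_)
open import Data.List using (List; []; _∷_; length; map; sum; filter; allFin; concatMap)
open import Data.Product using (Σ; _×_; _,_; ∃)
open import Data.Integer using (+_)
open import Data.Rational using (ℚ; _/_)
open import Relation.Binary.PropositionalEquality using (_≡_; _≢_)
open import Relation.Nullary using (¬_; Dec; yes; no)
open import Relation.Nullary.Decidable using (_×-dec_)
open import Data.Fin.Properties using (_≟_)

toℚ : ℕ → ℚ
toℚ n = + n / 1

-- An r-colouring of the edges of K_n: a colour for every ordered pair of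
-- distinct vertices, symmetric in the two endpoints (the value on the
-- diagonal u = u is irrelevant and never used).
record Coloring (n r : ℕ) : Set where
  field
    col  : Fin n → Fin n → Fin r
    symm : ∀ u v → u ≢ v → col u v ≡ col v u
open Coloring public

data Reach {n r : ℕ} (c : Coloring n r) (i : Fin r) (u : Fin n) : Fin n → Set where
  here : Reach c i u u
  step : ∀ {v w} → Reach c i u v → v ≢ w → col c v w ≡ i → Reach c i u w

-- Components of different colours are distinct
-- since the colour is part of the data.
Component : (n r : ℕ) → Set
Component n r = Fin r × Subset n

IsComponent : ∀ {n r} → Coloring n r → Component n r → Set
IsComponent {n} c (i , S) =
  Σ (Fin n) λ v → ∀ u → (u ∈ S → Reach c i v u) × (Reach c i v u → u ∈ S)

vsize : ∀ {n r} → Component n r → ℕ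
vsize (i , S) = Data.Fin.Subset.∣ S ∣

isEdge : ∀ {n r} → Coloring n r → Component n r → Fin n × Fin n → Set
isEdge c (i , S) (u , v) = (toℕ u < toℕ v) × ((u ∈ S) × ((v ∈ S) × (col c u v ≡ i)))

isEdge? : ∀ {n r} (c : Coloring n r) (C : Component n r) p → Dec (isEdge c C p)
isEdge? c (i , S) (u , v) =
  (toℕ u <? toℕ v) ×-dec ((u ∈? S) ×-dec ((v ∈? S) ×-dec (col c u v ≟ i)))

allPairs : (n : ℕ) → List (Fin n × Fin n)
allPairs n = concatMap (λ u → map (λ v → (u , v)) (allFin n)) (allFin n)

esize : ∀ {n r} → Coloring n r → Component n r → ℕ
esize {n} c C = length (filter (isEdge? c C) (allPairs n))

-- Suppose every monochromatic component has fewer than z·N edges, where N = C(n,2).  A component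
-- with w vertices has e ≤ C(w,2) ≤ N·w²/n² edges, so e² < zN·N·w²/n², that is e < √z·N·w/n.  The
-- components of one colour partition the vertex set, and the components of all colours together
-- partition the edge set of K_n.  Hence the components outside 𝒳, whose sizes add up to at most
-- (r − γ)n, have at most √z(r − γ)·N ≤ (1 − xz)·N edges in total, while the x components of 𝒳
-- have fewer than xz·N: fewer than N edges altogether, which is absurd.  Squares are compared
-- instead of square roots, and as all the counts are decidable, a component with at least z·N
-- edges is found by exhaustive search.
module Submission where

-- Kept in a module of its own: its ℕ arithmetic operators would clash with the ℚ ones used below.
module Combinatorics where

  open import Data.Bool.Base using (Bool; true; false; not; _∧_; if_then_else_; T)
  import Data.Bool.Properties as Bool
  open import Data.Fin.Base using (Fin; zero; suc; toℕ)
  open import Data.Fin.Properties using (_≟_; any?)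
  open import Data.Fin.Subset using (Subset; _∈_; _∉_; _⊆_; _⊂_; _∪_; ⁅_⁆; ∣_∣)
  open import Data.Fin.Subset.Properties
    using ( _∈?_; ∣p∣≤n; p⊂q⇒∣p∣<∣q∣; p⊆p∪q; x∈p∪q⁺; x∈p∪q⁻; x∈⁅x⁆; x∈⁅y⁆⇒x≡y; ∣⁅x⁆∣≡1
          ; ⊆-antisym)
  open import Data.List.Base using (List; []; _∷_; _++_; length; map; filter; tabulate; concatMap; allFin)
  open import Data.List.Properties using (filter-++; length-++; map-tabulate)
  open import Data.List.Relation.Unary.All using (All; []; _∷_)
  open import Data.List.Relation.Unary.AllPairs using ([]; _∷_)
  open import Data.List.Relation.Unary.Unique.Propositional using (Unique)
  open import Data.Nat.Base using (ℕ; zero; suc; _+_; _*_; _∸_; _≤_; _<_; _<ᵇ_; z≤n; s≤s)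
  open import Data.Nat.Combinatorics using (_C_; nC1≡n; nCk+nC[k+1]≡[n+1]C[k+1])
  open import Data.Nat.ListAction using (sum)
  open import Data.Nat.Properties hiding (_≟_)
  open import Data.Nat.Tactic.RingSolver using (solve-∀)
  open import Algebra.Properties.Semiring.Sum +-*-semiring
    using (sum-syntax; sum-cong-≗; ∑-distrib-+; ∑-comm; *-distribˡ-sum; *-distribʳ-sum)
    renaming (sum to ∑)
  open import Data.Product.Base using (_×_; _,_; ∃₂; proj₁; proj₂)
  open import Data.Product.Properties using (≡-dec; ,-injectiveˡ; ,-injectiveʳ)
  open import Data.Sum.Base using (inj₁; inj₂)
  open import Data.Vec.Base using (lookup; _∷_; [])
  import Data.Vec.Properties as Vec
  open import Data.Vec.Properties using ([]=⇒lookup; lookup⇒[]=)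
  open import Function.Base using (_∘_; _∘₂_)
  open import Relation.Binary.Definitions using (DecidableEquality)
  open import Relation.Binary.PropositionalEquality
  open import Relation.Nullary.Decidable using (dec-true; dec-false)
  open import Relation.Nullary.Decidable.Core using (Dec; yes; no; does; ¬?; _×-dec_)
  open import Relation.Nullary.Negation.Core using (contradiction)
  open import Relation.Unary using (Pred; Decidable)

  open import Defs

  𝟙 : Bool → ℕ
  𝟙 b = if b then 1 else 0

  𝟙-∧ : ∀ a b → 𝟙 (a ∧ b) ≡ 𝟙 a * 𝟙 b
  𝟙-∧ true  b = sym (+-identityʳ (𝟙 b))
  𝟙-∧ false b = refl

  ∑-const : ∀ n c → ∑[ i < n ] c ≡ n * c
  ∑-const zero    c = refl
  ∑-const (suc n) c = cong (c +_) (∑-const n c)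

  ∑-zero : ∀ {n} (f : Fin n → ℕ) → (∀ i → f i ≡ 0) → ∑ f ≡ 0
  ∑-zero {n} f f≡0 = trans (sum-cong-≗ f≡0) (trans (∑-const n 0) (*-zeroʳ n))

  ∑-mono-≤ : ∀ {n} {f g : Fin n → ℕ} → (∀ i → f i ≤ g i) → ∑ f ≤ ∑ g
  ∑-mono-≤ {zero}  f≤g = z≤n
  ∑-mono-≤ {suc n} f≤g = +-mono-≤ (f≤g zero) (∑-mono-≤ (f≤g ∘ suc))

  ∑-𝟙-≟ : ∀ {n} (j : Fin n) (f : Fin n → ℕ) → ∑[ i < n ] (f i * 𝟙 (does (j ≟ i))) ≡ f j
  ∑-𝟙-≟ {suc n} zero    f = trans
    (cong₂ _+_ (*-identityʳ (f zero)) (∑-zero {n} _ λ i → *-zeroʳ (f (suc i))))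
    (+-identityʳ (f zero))
  ∑-𝟙-≟ {suc n} (suc j) f = trans
    (cong (_+ ∑[ i < n ] (f (suc i) * 𝟙 (does (j ≟ i)))) (*-zeroʳ (f zero)))
    (∑-𝟙-≟ j (f ∘ suc))

  first : ∀ {n} → (Fin n → Bool) → Fin n → Bool
  first P zero    = P zero
  first P (suc u) = not (P zero) ∧ first (P ∘ suc) u

  first⇒ : ∀ {n} (P : Fin n → Bool) u → first P u ≡ true → P u ≡ true
  first⇒ P zero    Pu = Pu
  first⇒ P (suc u) Pu with P zero
  ... | false = first⇒ (P ∘ suc) u Pu

  ∑-𝟙-first : ∀ {n} (P : Fin n → Bool) j → P j ≡ true → ∑[ u < n ] 𝟙 (first P u) ≡ 1
  ∑-𝟙-first {suc n} P j Pj with P zero in P₀ | j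
  ... | true  | _      = cong suc (∑-zero {n} _ λ _ → refl)
  ... | false | zero   = contradiction (trans (sym Pj) P₀) λ ()
  ... | false | suc j′ = ∑-𝟙-first (P ∘ suc) j′ Pj

  module _ {a p} {A : Set a} {P : Pred A p} (P? : Decidable P) where

    length-filter-tabulate : ∀ {m} (f : Fin m → A) →
      length (filter P? (tabulate f)) ≡ ∑[ k < m ] 𝟙 (does (P? (f k)))
    length-filter-tabulate {zero}  f = refl
    length-filter-tabulate {suc m} f with does (P? (f zero))
    ... | true  = cong suc (length-filter-tabulate (f ∘ suc))
    ... | false = length-filter-tabulate (f ∘ suc)

    length-filter-concatMap-tabulate : ∀ {b} {B : Set b} {m} (g : B → List A) (f : Fin m → B) →
      length (filter P? (concatMap g (tabulate f))) ≡ ∑[ k < m ] length (filter P? (g (f k)))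
    length-filter-concatMap-tabulate {m = zero}  g f = refl
    length-filter-concatMap-tabulate {m = suc m} g f = begin
      length (filter P? (g (f zero) ++ rest))
        ≡⟨ cong length (filter-++ P? (g (f zero)) rest) ⟩
      length (filter P? (g (f zero)) ++ filter P? rest)
        ≡⟨ length-++ (filter P? (g (f zero))) ⟩
      length (filter P? (g (f zero))) + length (filter P? rest)
        ≡⟨ cong (length (filter P? (g (f zero))) +_) (length-filter-concatMap-tabulate g (f ∘ suc)) ⟩
      length (filter P? (g (f zero))) + ∑[ k < m ] length (filter P? (g (f (suc k)))) ∎
      where
      open ≡-Reasoning
      rest : List A
      rest = concatMap g (tabulate (f ∘ suc))

  ∣p∣≡∑𝟙 : ∀ {n} (p : Subset n) → ∣ p ∣ ≡ ∑[ a < n ] 𝟙 (lookup p a)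
  ∣p∣≡∑𝟙 []          = refl
  ∣p∣≡∑𝟙 (true  ∷ p) = cong suc (∣p∣≡∑𝟙 p)
  ∣p∣≡∑𝟙 (false ∷ p) = ∣p∣≡∑𝟙 p

  does-∈? : ∀ {n} x (p : Subset n) → does (x ∈? p) ≡ lookup p x
  does-∈? zero    (true  ∷ p) = refl
  does-∈? zero    (false ∷ p) = refl
  does-∈? (suc x) (_     ∷ p) = does-∈? x p

  ∈⇔⇒lookup-≡ : ∀ {n} {x y} (p : Subset n) → (x ∈ p → y ∈ p) → (y ∈ p → x ∈ p) →
                lookup p x ≡ lookup p y
  ∈⇔⇒lookup-≡ {x = x} {y} p x⇒y y⇒x with lookup p x in px | lookup p y in py
  ... | true  | true  = refl
  ... | false | false = refl
  ... | true  | false = contradiction (trans (sym ([]=⇒lookup (x⇒y (lookup⇒[]= x p px)))) py) λ ()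
  ... | false | true  = contradiction (trans (sym ([]=⇒lookup (y⇒x (lookup⇒[]= y p py)))) px) λ ()

  ∑-pairs : ∀ {n} (P : Fin n → Bool) →
    ∑[ a < n ] ∑[ b < n ] (𝟙 (toℕ a <ᵇ toℕ b) * (𝟙 (P a) * 𝟙 (P b))) ≡ (∑[ a < n ] 𝟙 (P a)) C 2
  ∑-pairs {zero}  P = refl
  ∑-pairs {suc n} P with P zero
  ... | false = cong₂ _+_ (∑-zero {n} _ λ _ → refl) (∑-pairs (P ∘ suc))
  ... | true  = begin
    ∑[ b < n ] (1 * 𝟙 (P (suc b)) + 0) + _
      ≡⟨ cong₂ _+_ (sum-cong-≗ λ b → trans (+-identityʳ _) (*-identityˡ (𝟙 (P (suc b)))))
                   (∑-pairs (P ∘ suc)) ⟩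
    s + s C 2       ≡⟨ cong (_+ s C 2) (nC1≡n s) ⟨
    s C 1 + s C 2   ≡⟨ nCk+nC[k+1]≡[n+1]C[k+1] s 1 ⟩
    suc s C 2       ∎
    where
    open ≡-Reasoning
    s : ℕ
    s = ∑[ b < n ] 𝟙 (P (suc b))

  ∑-<ᵇ : ∀ n → ∑[ a < n ] ∑[ b < n ] 𝟙 (toℕ a <ᵇ toℕ b) ≡ n C 2
  ∑-<ᵇ n = begin
    ∑[ a < n ] ∑[ b < n ] 𝟙 (toℕ a <ᵇ toℕ b)
      ≡⟨ sum-cong-≗ {n} (λ a → sum-cong-≗ {n} λ b → *-identityʳ (𝟙 (toℕ a <ᵇ toℕ b))) ⟨
    ∑[ a < n ] ∑[ b < n ] (𝟙 (toℕ a <ᵇ toℕ b) * (𝟙 true * 𝟙 true))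
      ≡⟨ ∑-pairs {n} (λ _ → true) ⟩
    (∑[ a < n ] 1) C 2
      ≡⟨ cong (_C 2) (trans (∑-const n 1) (*-identityʳ n)) ⟩
    n C 2 ∎
    where open ≡-Reasoning

  2*[1+n]C2≡[1+n]*n : ∀ n → 2 * (suc n C 2) ≡ suc n * n
  2*[1+n]C2≡[1+n]*n zero    = refl
  2*[1+n]C2≡[1+n]*n (suc n) = begin
    2 * (suc (suc n) C 2)                ≡⟨ cong (2 *_) (nCk+nC[k+1]≡[n+1]C[k+1] (suc n) 1) ⟨
    2 * (suc n C 1 + suc n C 2)          ≡⟨ *-distribˡ-+ 2 (suc n C 1) (suc n C 2) ⟩
    2 * (suc n C 1) + 2 * (suc n C 2)
      ≡⟨ cong₂ (λ x y → 2 * x + y) (nC1≡n (suc n)) (2*[1+n]C2≡[1+n]*n n) ⟩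
    2 * suc n + suc n * n                ≡⟨ rearrange n ⟩
    suc (suc n) * suc n                  ∎
    where
    open ≡-Reasoning
    rearrange : ∀ n → 2 * suc n + suc n * n ≡ suc (suc n) * suc n
    rearrange = solve-∀

  w≤n⇒n*n*wC2≤nC2*w*w : ∀ {w n} → w ≤ n → n * n * (w C 2) ≤ (n C 2) * (w * w)
  w≤n⇒n*n*wC2≤nC2*w*w {zero}  {n}     _         =
    ≤-reflexive (trans (*-zeroʳ (n * n)) (sym (*-zeroʳ (n C 2))))
  w≤n⇒n*n*wC2≤nC2*w*w {suc w} {suc n} (s≤s w≤n) = *-cancelˡ-≤ 2 (begin
    2 * (suc n * suc n * (suc w C 2))       ≡⟨ swap₁ (suc n) (suc w C 2) ⟩
    suc n * suc n * (2 * (suc w C 2))       ≡⟨ cong (suc n * suc n *_) (2*[1+n]C2≡[1+n]*n w) ⟩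
    suc n * suc n * (suc w * w)             ≡⟨ swap₂ (suc n) (suc w) w ⟩
    (suc n * suc w) * (suc n * w)           ≤⟨ *-monoʳ-≤ (suc n * suc w) [1+n]w≤n[1+w] ⟩
    (suc n * suc w) * (n * suc w)           ≡⟨ swap₃ (suc n) (suc w) n ⟩
    (suc n * n) * (suc w * suc w)           ≡⟨ cong (_* (suc w * suc w)) (2*[1+n]C2≡[1+n]*n n) ⟨
    (2 * (suc n C 2)) * (suc w * suc w)     ≡⟨ *-assoc 2 (suc n C 2) _ ⟩
    2 * ((suc n C 2) * (suc w * suc w))     ∎)
    where
    open ≤-Reasoning
    [1+n]w≤n[1+w] : suc n * w ≤ n * suc w
    [1+n]w≤n[1+w] = subst (w + n * w ≤_) (sym (*-suc n w)) (+-monoˡ-≤ (n * w) w≤n)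
    swap₁ : ∀ a b → 2 * (a * a * b) ≡ a * a * (2 * b)
    swap₁ = solve-∀
    swap₂ : ∀ a b d → a * a * (b * d) ≡ (a * b) * (a * d)
    swap₂ = solve-∀
    swap₃ : ∀ a b d → (a * b) * (d * b) ≡ (a * d) * (b * b)
    swap₃ = solve-∀

  esize≡∑ : ∀ {n r} (c : Coloring n r) K →
            esize c K ≡ ∑[ a < n ] ∑[ b < n ] 𝟙 (does (isEdge? c K (a , b)))
  esize≡∑ {n} c K = trans
    (length-filter-concatMap-tabulate (isEdge? c K) (λ a → map (a ,_) (allFin n)) (λ a → a))
    (sum-cong-≗ λ a → trans (cong (length ∘ filter (isEdge? c K)) (map-tabulate (λ b → b) (a ,_)))
                            (length-filter-tabulate (isEdge? c K) (a ,_)))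

  esize≤vsizeC2 : ∀ {n r} (c : Coloring n r) K → esize c K ≤ vsize K C 2
  esize≤vsizeC2 {n} c K@(i , S) = begin
    esize c K
      ≡⟨ esize≡∑ c K ⟩
    ∑[ a < n ] ∑[ b < n ] 𝟙 (does (isEdge? c K (a , b)))
      ≤⟨ ∑-mono-≤ (λ a → ∑-mono-≤ λ b → edge≤pair a b) ⟩
    ∑[ a < n ] ∑[ b < n ] (𝟙 (toℕ a <ᵇ toℕ b) * (𝟙 (lookup S a) * 𝟙 (lookup S b)))
      ≡⟨ ∑-pairs (lookup S) ⟩
    (∑[ a < n ] 𝟙 (lookup S a)) C 2
      ≡⟨ cong (_C 2) (∣p∣≡∑𝟙 S) ⟨
    ∣ S ∣ C 2 ∎
    where
    open ≤-Reasoning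
    𝟙-∧-≤ : ∀ l x y d → 𝟙 (l ∧ (x ∧ (y ∧ d))) ≤ 𝟙 l * (𝟙 x * 𝟙 y)
    𝟙-∧-≤ true  true  true  true  = ≤-refl
    𝟙-∧-≤ true  true  true  false = z≤n
    𝟙-∧-≤ true  true  false _     = z≤n
    𝟙-∧-≤ true  false _     _     = z≤n
    𝟙-∧-≤ false _     _     _     = z≤n
    edge≤pair : ∀ a b →
      𝟙 (does (isEdge? c K (a , b))) ≤ 𝟙 (toℕ a <ᵇ toℕ b) * (𝟙 (lookup S a) * 𝟙 (lookup S b))
    edge≤pair a b rewrite does-∈? a S | does-∈? b S =
      𝟙-∧-≤ (toℕ a <ᵇ toℕ b) (lookup S a) (lookup S b) (does (col c a b ≟ i))

  n*n*esize≤nC2*vsize² : ∀ {n r} (c : Coloring n r) K →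
                         n * n * esize c K ≤ (n C 2) * (vsize K * vsize K)
  n*n*esize≤nC2*vsize² {n} c K@(_ , S) =
    ≤-trans (*-monoʳ-≤ (n * n) (esize≤vsizeC2 c K)) (w≤n⇒n*n*wC2≤nC2*w*w (∣p∣≤n S))

  n*esize≤nC2*vsize : ∀ {n r} (c : Coloring n r) K → 1 ≤ n → n * esize c K ≤ (n C 2) * vsize K
  n*esize≤nC2*vsize {n@(suc _)} c K@(_ , S) _ = *-cancelʳ-≤ (n * e) (N * w) n (begin
    n * e * n      ≡⟨ *-comm (n * e) n ⟩
    n * (n * e)    ≡⟨ *-assoc n n e ⟨
    n * n * e      ≤⟨ n*n*esize≤nC2*vsize² c K ⟩
    N * (w * w)    ≤⟨ *-monoʳ-≤ N (*-monoʳ-≤ w (∣p∣≤n S)) ⟩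
    N * (w * n)    ≡⟨ *-assoc N w n ⟨
    N * w * n      ∎)
    where
    open ≤-Reasoning
    N e w : ℕ
    N = n C 2
    e = esize c K
    w = vsize K

  <ᵇ⇒≢ : ∀ {n} {a b : Fin n} → T (toℕ a <ᵇ toℕ b) → a ≢ b
  <ᵇ⇒≢ {a = a} {b} a<b a≡b = <-irrefl (cong toℕ a≡b) (<ᵇ⇒< (toℕ a) (toℕ b) a<b)

  Reach-trans : ∀ {n r} {c : Coloring n r} {i u v w} → Reach c i u v → Reach c i v w → Reach c i u w
  Reach-trans u⇝v here                = u⇝v
  Reach-trans u⇝v (step v⇝x x≢w xw≡i) = step (Reach-trans u⇝v v⇝x) x≢w xw≡i

  Reach-sym : ∀ {n r} {c : Coloring n r} {i u v} → Reach c i u v → Reach c i v u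
  Reach-sym         here                          = here
  Reach-sym {c = c} (step {x} {w} u⇝x x≢w xw≡i) =
    Reach-trans (step here (x≢w ∘ sym) (trans (sym (symm c x w x≢w)) xw≡i)) (Reach-sym u⇝x)

  module Closure {n r} (c : Coloring n r) (i : Fin r) where

    Adjacent : Fin n → Fin n → Set
    Adjacent x w = x ≢ w × col c x w ≡ i

    LeavingEdge : Subset n → Set
    LeavingEdge S = ∃₂ λ x w → x ∈ S × w ∉ S × Adjacent x w

    leavingEdge? : ∀ S → Dec (LeavingEdge S)
    leavingEdge? S = any? λ x → any? λ w →
      x ∈? S ×-dec ¬? (w ∈? S) ×-dec ¬? (x ≟ w) ×-dec (col c x w ≟ i)

    Closed : Subset n → Set
    Closed S = ∀ {x w} → x ∈ S → Adjacent x w → w ∈ S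

    grow : ℕ → Subset n → Subset n
    grow zero    S = S
    grow (suc k) S with leavingEdge? S
    ... | yes (_ , w , _) = grow k (S ∪ ⁅ w ⁆)
    ... | no  _           = S

    ⊆-grow : ∀ k {S} → S ⊆ grow k S
    ⊆-grow zero        x∈S = x∈S
    ⊆-grow (suc k) {S} x∈S with leavingEdge? S
    ... | yes (_ , w , _) = ⊆-grow k (p⊆p∪q ⁅ w ⁆ x∈S)
    ... | no  _           = x∈S

    -- Each step adds a vertex, so more than n ∸ ∣ S ∣ steps of fuel always reach a closed set.
    grow-closed : ∀ k S → n < k + ∣ S ∣ → Closed (grow k S)
    grow-closed zero    S n<∣S∣   = contradiction (∣p∣≤n S) (<⇒≱ n<∣S∣)
    grow-closed (suc k) S n<k+∣S∣ with leavingEdge? S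
    ... | yes (_ , w , _ , w∉S , _) = grow-closed k (S ∪ ⁅ w ⁆) (<-≤-trans n<k+∣S∣ (begin
      suc k + ∣ S ∣       ≡⟨ +-suc k ∣ S ∣ ⟨
      k + suc ∣ S ∣       ≤⟨ +-monoʳ-≤ k (p⊂q⇒∣p∣<∣q∣ S⊂S∪w) ⟩
      k + ∣ S ∪ ⁅ w ⁆ ∣   ∎))
      where
      open ≤-Reasoning
      S⊂S∪w : S ⊂ S ∪ ⁅ w ⁆
      S⊂S∪w = p⊆p∪q ⁅ w ⁆ , w , x∈p∪q⁺ (inj₂ (x∈⁅x⁆ w)) , w∉S
    ... | no  ¬leaving = closed
      where
      closed : Closed S
      closed {x} {w} x∈S adj with w ∈? S
      ... | yes w∈S = w∈S
      ... | no  w∉S = contradiction (x , w , x∈S , w∉S , adj) ¬leaving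

    grow-reach : ∀ {u} k {S} → (∀ {v} → v ∈ S → Reach c i u v) →
                 ∀ {v} → v ∈ grow k S → Reach c i u v
    grow-reach zero        reach = reach
    grow-reach (suc k) {S} reach with leavingEdge? S
    ... | no  _                       = reach
    ... | yes (x , w , x∈S , _ , adj) = grow-reach k reach′
      where
      reach′ : ∀ {v} → v ∈ S ∪ ⁅ w ⁆ → Reach c i _ v
      reach′ v∈S∪w with x∈p∪q⁻ S ⁅ w ⁆ v∈S∪w
      ... | inj₁ v∈S = reach v∈S
      ... | inj₂ v∈w rewrite x∈⁅y⁆⇒x≡y w v∈w = step (reach x∈S) (proj₁ adj) (proj₂ adj)

    closed-reach : ∀ {S u v} → Closed S → u ∈ S → Reach c i u v → v ∈ S
    closed-reach closed u∈S here                = u∈S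
    closed-reach closed u∈S (step u⇝x x≢w xw≡i) =
      closed (closed-reach closed u∈S u⇝x) (x≢w , xw≡i)

    closure : Fin n → Subset n
    closure u = grow n ⁅ u ⁆

    u∈closure : ∀ u → u ∈ closure u
    u∈closure u = ⊆-grow n (x∈⁅x⁆ u)

    ∈closure⇒Reach : ∀ {u v} → v ∈ closure u → Reach c i u v
    ∈closure⇒Reach {u} =
      grow-reach n λ v∈⁅u⁆ → subst (Reach c i u) (sym (x∈⁅y⁆⇒x≡y u v∈⁅u⁆)) here

    Reach⇒∈closure : ∀ {u v} → Reach c i u v → v ∈ closure u
    Reach⇒∈closure {u} =
      closed-reach (grow-closed n ⁅ u ⁆ (m<m+n n (≤-reflexive (sym (∣⁅x⁆∣≡1 u))))) (u∈closure u)

    closure-sym : ∀ {u v} → v ∈ closure u → u ∈ closure v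
    closure-sym = Reach⇒∈closure ∘ Reach-sym ∘ ∈closure⇒Reach

    closure-≡ : ∀ {u v} → v ∈ closure u → closure v ≡ closure u
    closure-≡ v∈u = ⊆-antisym
      (Reach⇒∈closure ∘ Reach-trans (∈closure⇒Reach v∈u) ∘ ∈closure⇒Reach)
      (Reach⇒∈closure ∘ Reach-trans (Reach-sym (∈closure⇒Reach v∈u)) ∘ ∈closure⇒Reach)

  _≟ᶜ_ : ∀ {n r} → DecidableEquality (Component n r)
  _≟ᶜ_ = ≡-dec _≟_ (Vec.≡-dec Bool._≟_)

  multiplicity : ∀ {n r} → List (Component n r) → Component n r → ℕ
  multiplicity []      L = 0
  multiplicity (K ∷ X) L = 𝟙 (does (K ≟ᶜ L)) + multiplicity X L

  multiplicity-∉ : ∀ {n r} {K : Component n r} {X} → All (K ≢_) X → multiplicity X K ≡ 0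
  multiplicity-∉ []                           = refl
  multiplicity-∉ {K = K} {L ∷ X} (K≢L ∷ K∉X) =
    cong₂ _+_ (cong 𝟙 (dec-false (L ≟ᶜ K) (K≢L ∘ sym))) (multiplicity-∉ K∉X)

  multiplicity≤1 : ∀ {n r} {X : List (Component n r)} → Unique X → ∀ L → multiplicity X L ≤ 1
  multiplicity≤1 []                         L = z≤n
  multiplicity≤1 {X = K ∷ X} (K∉X ∷ X!) L with K ≟ᶜ L
  ... | yes refl = ≤-reflexive (cong suc (multiplicity-∉ K∉X))
  ... | no  _    = multiplicity≤1 X! L

  module Components {n r} (c : Coloring n r) where

    open Closure c

    component : Fin r → Fin n → Component n r
    component i u = i , closure i u

    component-isComponent : ∀ i u → IsComponent c (component i u)
    component-isComponent i u = u , λ v → ∈closure⇒Reach i , Reach⇒∈closure i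

    isComponent⇒component : ∀ {K} → IsComponent c K → ∃₂ λ i u → K ≡ component i u
    isComponent⇒component {i , S} (u , S≈reach) = i , u , cong (i ,_) (⊆-antisym
      (λ v∈S → Reach⇒∈closure i (proj₁ (S≈reach _) v∈S))
      (λ v∈closure → proj₂ (S≈reach _) (∈closure⇒Reach i v∈closure)))

    leader : Fin r → Fin n → Bool
    leader i u = first (lookup (closure i u)) u

    leader*∈≡first : ∀ i a u →
      𝟙 (leader i u) * 𝟙 (lookup (closure i u) a) ≡ 𝟙 (first (lookup (closure i a)) u)
    leader*∈≡first i a u with lookup (closure i u) a in a∈u
    ... | true rewrite closure-≡ i (lookup⇒[]= a (closure i u) a∈u) = *-identityʳ _
    ... | false with first (lookup (closure i a)) u in u-first
    ...   | false = *-zeroʳ (𝟙 (leader i u))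
    ...   | true  = contradiction (trans (sym a∈u) ([]=⇒lookup (closure-sym i u∈a))) λ ()
      where
      u∈a : u ∈ closure i a
      u∈a = lookup⇒[]= u (closure i a) (first⇒ (lookup (closure i a)) u u-first)

    leaders-cover : ∀ i a → ∑[ u < n ] (𝟙 (leader i u) * 𝟙 (lookup (closure i u) a)) ≡ 1
    leaders-cover i a = trans (sum-cong-≗ (leader*∈≡first i a))
      (∑-𝟙-first (lookup (closure i a)) a ([]=⇒lookup (u∈closure i a)))

    -- Each component is counted once, at its least vertex (its leader).
    ∑ᶜ : (Component n r → ℕ) → ℕ
    ∑ᶜ G = ∑[ i < r ] ∑[ u < n ] (𝟙 (leader i u) * G (component i u))

    ∑ᶜ-cong : ∀ F G → (∀ i u → F (component i u) ≡ G (component i u)) → ∑ᶜ F ≡ ∑ᶜ G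
    ∑ᶜ-cong F G F≗G = sum-cong-≗ λ i → sum-cong-≗ λ u → cong (𝟙 (leader i u) *_) (F≗G i u)

    ∑ᶜ-distrib-+ : ∀ F G → ∑ᶜ (λ K → F K + G K) ≡ ∑ᶜ F + ∑ᶜ G
    ∑ᶜ-distrib-+ F G = trans
      (sum-cong-≗ λ i → trans (sum-cong-≗ λ u → *-distribˡ-+ (𝟙 (leader i u)) _ _)
                              (∑-distrib-+ (F′ i) (G′ i)))
      (∑-distrib-+ (∑ ∘ F′) (∑ ∘ G′))
      where
      F′ G′ : Fin r → Fin n → ℕ
      F′ i u = 𝟙 (leader i u) * F (component i u)
      G′ i u = 𝟙 (leader i u) * G (component i u)

    ∑ᶜ-*ʳ : ∀ F m → ∑ᶜ (λ K → F K * m) ≡ ∑ᶜ F * m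
    ∑ᶜ-*ʳ F m = trans
      (sum-cong-≗ λ i → trans (sum-cong-≗ λ u → sym (*-assoc (𝟙 (leader i u)) _ m))
                              (sym (*-distribʳ-sum m (F′ i))))
      (sym (*-distribʳ-sum m (∑ ∘ F′)))
      where
      F′ : Fin r → Fin n → ℕ
      F′ i u = 𝟙 (leader i u) * F (component i u)

    ∑ᶜ-vertices : ∀ (h : Fin r → Fin n → ℕ) →
      ∑ᶜ (λ (i , S) → ∑[ a < n ] (𝟙 (lookup S a) * h i a)) ≡ ∑[ i < r ] ∑[ a < n ] h i a
    ∑ᶜ-vertices h = sum-cong-≗ λ i → begin
      ∑[ u < n ] (𝟙 (leader i u) * ∑[ a < n ] (𝟙 (lookup (closure i u) a) * h i a))
        ≡⟨ sum-cong-≗ (λ u → *-distribˡ-sum (𝟙 (leader i u)) λ a → 𝟙 (lookup (closure i u) a) * h i a) ⟩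
      ∑[ u < n ] ∑[ a < n ] (𝟙 (leader i u) * (𝟙 (lookup (closure i u) a) * h i a))
        ≡⟨ ∑-comm (λ u a → 𝟙 (leader i u) * (𝟙 (lookup (closure i u) a) * h i a)) ⟩
      ∑[ a < n ] ∑[ u < n ] (𝟙 (leader i u) * (𝟙 (lookup (closure i u) a) * h i a))
        ≡⟨ sum-cong-≗ (λ a → trans (sum-cong-≗ λ u → sym (*-assoc (𝟙 (leader i u)) _ (h i a)))
                                    (sym (*-distribʳ-sum (h i a) (covers i a)))) ⟩
      ∑[ a < n ] (∑ (covers i a) * h i a)
        ≡⟨ sum-cong-≗ (λ a → trans (cong (_* h i a) (leaders-cover i a)) (*-identityˡ (h i a))) ⟩
      ∑[ a < n ] h i a ∎
      where
      open ≡-Reasoning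
      covers : Fin r → Fin n → Fin n → ℕ
      covers i a u = 𝟙 (leader i u) * 𝟙 (lookup (closure i u) a)

    ∑ᶜ-vsize : ∑ᶜ vsize ≡ r * n
    ∑ᶜ-vsize = begin
      ∑ᶜ vsize                  ≡⟨ ∑ᶜ-cong vsize size (λ i u → trans (∣p∣≡∑𝟙 (closure i u))
                                     (sum-cong-≗ λ a → sym (*-identityʳ (𝟙 (lookup (closure i u) a))))) ⟩
      ∑ᶜ size                   ≡⟨ ∑ᶜ-vertices (λ _ _ → 1) ⟩
      ∑[ i < r ] ∑[ a < n ] 1   ≡⟨ ∑-const r (∑[ a < n ] 1) ⟩
      r * ∑[ a < n ] 1          ≡⟨ cong (r *_) (trans (∑-const n 1) (*-identityʳ n)) ⟩
      r * n                     ∎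
      where
      open ≡-Reasoning
      size : Component n r → ℕ
      size (_ , S) = ∑[ a < n ] (𝟙 (lookup S a) * 1)

    lookup-adjacent : ∀ i u {a b} → a ≢ b → col c a b ≡ i →
                      lookup (closure i u) b ≡ lookup (closure i u) a
    lookup-adjacent i u {a} {b} a≢b ab≡i = ∈⇔⇒lookup-≡ (closure i u)
      (λ b∈ → Reach⇒∈closure i (step (∈closure⇒Reach i b∈) b≢a (trans (symm c b a b≢a) ab≡i)))
      (λ a∈ → Reach⇒∈closure i (step (∈closure⇒Reach i a∈) a≢b ab≡i))
      where
      b≢a : b ≢ a
      b≢a = a≢b ∘ sym

    edge-indicator : ∀ i u a b → 𝟙 (does (isEdge? c (component i u) (a , b)))
                   ≡ 𝟙 (lookup (closure i u) a) * 𝟙 ((toℕ a <ᵇ toℕ b) ∧ does (col c a b ≟ i))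
    edge-indicator i u a b rewrite does-∈? a (closure i u) | does-∈? b (closure i u)
      with toℕ a <ᵇ toℕ b in a<b | col c a b ≟ i
    ... | false | _        = sym (*-zeroʳ (𝟙 (lookup (closure i u) a)))
    ... | true  | no  _    =
      trans (cong 𝟙 (∧-false (lookup (closure i u) a) _)) (sym (*-zeroʳ (𝟙 (lookup (closure i u) a))))
      where
      ∧-false : ∀ x y → x ∧ (y ∧ false) ≡ false
      ∧-false x y = trans (cong (x ∧_) (Bool.∧-zeroʳ y)) (Bool.∧-zeroʳ x)
    ... | true  | yes ab≡i rewrite lookup-adjacent i u (<ᵇ⇒≢ (subst T (sym a<b) _)) ab≡i =
      𝟙-∧-idem (lookup (closure i u) a)
      where
      𝟙-∧-idem : ∀ x → 𝟙 (x ∧ (x ∧ true)) ≡ 𝟙 x * 1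
      𝟙-∧-idem true  = refl
      𝟙-∧-idem false = refl

    ∑ᶜ-esize : ∑ᶜ (esize c) ≡ n C 2
    ∑ᶜ-esize = begin
      ∑ᶜ (esize c)
        ≡⟨ ∑ᶜ-cong (esize c) edges (λ i u → trans (esize≡∑ c (component i u)) (sum-cong-≗ λ a →
             trans (sum-cong-≗ (edge-indicator i u a))
                   (sym (*-distribˡ-sum (𝟙 (lookup (closure i u) a)) (h i a))))) ⟩
      ∑ᶜ edges
        ≡⟨ ∑ᶜ-vertices (λ i a → ∑ (h i a)) ⟩
      ∑[ i < r ] ∑[ a < n ] ∑[ b < n ] h i a b
        ≡⟨ ∑-comm (λ i a → ∑ (h i a)) ⟩
      ∑[ a < n ] ∑[ i < r ] ∑[ b < n ] h i a b
        ≡⟨ sum-cong-≗ (λ a → ∑-comm (λ i → h i a)) ⟩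
      ∑[ a < n ] ∑[ b < n ] ∑[ i < r ] h i a b
        ≡⟨ sum-cong-≗ (λ a → sum-cong-≗ λ b →
             trans (sum-cong-≗ λ i → 𝟙-∧ (toℕ a <ᵇ toℕ b) (does (col c a b ≟ i)))
                   (∑-𝟙-≟ (col c a b) (λ _ → 𝟙 (toℕ a <ᵇ toℕ b)))) ⟩
      ∑[ a < n ] ∑[ b < n ] 𝟙 (toℕ a <ᵇ toℕ b)
        ≡⟨ ∑-<ᵇ n ⟩
      n C 2 ∎
      where
      open ≡-Reasoning
      h : Fin r → Fin n → Fin n → ℕ
      h i a b = 𝟙 ((toℕ a <ᵇ toℕ b) ∧ does (col c a b ≟ i))
      edges : Component n r → ℕ
      edges (i , S) = ∑[ a < n ] (𝟙 (lookup S a) * ∑ (h i a))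

    𝟙-component-≟ : ∀ j v i u →
      𝟙 (does (component j v ≟ᶜ component i u)) ≡ 𝟙 (lookup (closure i u) v) * 𝟙 (does (j ≟ i))
    𝟙-component-≟ j v i u with component j v ≟ᶜ component i u
    ... | yes jv≡iu with ,-injectiveˡ jv≡iu
    ...   | refl rewrite dec-true (j ≟ j) refl | sym (,-injectiveʳ jv≡iu) | []=⇒lookup (u∈closure j v) =
      refl
    𝟙-component-≟ j v i u | no jv≢iu with j ≟ i | lookup (closure i u) v in v∈u
    ... | no  _    | x     = sym (*-zeroʳ (𝟙 x))
    ... | yes _    | false = refl
    ... | yes refl | true  =
      contradiction (cong (j ,_) (closure-≡ j (lookup⇒[]= v (closure j u) v∈u))) jv≢iu

    ∑ᶜ-𝟙-≟ : ∀ {K} → IsComponent c K → ∑ᶜ (λ L → 𝟙 (does (K ≟ᶜ L))) ≡ 1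
    ∑ᶜ-𝟙-≟ K-component with isComponent⇒component K-component
    ... | j , v , refl = begin
      ∑[ i < r ] ∑[ u < n ] (𝟙 (leader i u) * 𝟙 (does (component j v ≟ᶜ component i u)))
        ≡⟨ sum-cong-≗ (λ i → sum-cong-≗ λ u → cong (𝟙 (leader i u) *_) (𝟙-component-≟ j v i u)) ⟩
      ∑[ i < r ] ∑[ u < n ] (𝟙 (leader i u) * (𝟙 (lookup (closure i u) v) * 𝟙 (does (j ≟ i))))
        ≡⟨ sum-cong-≗ (λ i → trans (sum-cong-≗ λ u → sym (*-assoc (𝟙 (leader i u)) _ _))
                                    (sym (*-distribʳ-sum (𝟙 (does (j ≟ i))) (covers i)))) ⟩
      ∑[ i < r ] (∑ (covers i) * 𝟙 (does (j ≟ i)))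
        ≡⟨ ∑-𝟙-≟ j (∑ ∘ covers) ⟩
      ∑ (covers j)
        ≡⟨ leaders-cover j v ⟩
      1 ∎
      where
      open ≡-Reasoning
      covers : Fin r → Fin n → ℕ
      covers i u = 𝟙 (leader i u) * 𝟙 (lookup (closure i u) v)

    ∑ᶜ-𝟙-≟-* : ∀ {K} → IsComponent c K → (G : Component n r → ℕ) →
               ∑ᶜ (λ L → 𝟙 (does (K ≟ᶜ L)) * G L) ≡ G K
    ∑ᶜ-𝟙-≟-* {K} K-component G = begin
      ∑ᶜ (λ L → 𝟙K L * G L)   ≡⟨ ∑ᶜ-cong (λ L → 𝟙K L * G L) (λ L → 𝟙K L * G K) (λ i u → at-K (component i u)) ⟩
      ∑ᶜ (λ L → 𝟙K L * G K)   ≡⟨ ∑ᶜ-*ʳ 𝟙K (G K) ⟩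
      ∑ᶜ 𝟙K * G K             ≡⟨ cong (_* G K) (∑ᶜ-𝟙-≟ K-component) ⟩
      1 * G K                 ≡⟨ *-identityˡ (G K) ⟩
      G K                     ∎
      where
      open ≡-Reasoning
      𝟙K : Component n r → ℕ
      𝟙K L = 𝟙 (does (K ≟ᶜ L))
      at-K : ∀ L → 𝟙K L * G L ≡ 𝟙K L * G K
      at-K L with K ≟ᶜ L
      ... | yes refl = refl
      ... | no  _    = refl

    ∑ᶜ-multiplicity : ∀ {X} → All (IsComponent c) X → (G : Component n r → ℕ) →
      ∑ᶜ (λ L → multiplicity X L * G L) ≡ sum (map G X)
    ∑ᶜ-multiplicity []                                     G =
      ∑-zero _ λ i → ∑-zero _ λ u → *-zeroʳ (𝟙 (leader i u))
    ∑ᶜ-multiplicity {K ∷ X} (K-component ∷ X-components) G = begin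
      ∑ᶜ (λ L → (𝟙 (does (K ≟ᶜ L)) + multiplicity X L) * G L)
        ≡⟨ ∑ᶜ-cong (λ L → (𝟙 (does (K ≟ᶜ L)) + multiplicity X L) * G L) (λ L → K-part L + X-part L)
                   (λ i u → *-distribʳ-+ (G (component i u)) (𝟙 (does (K ≟ᶜ component i u))) _) ⟩
      ∑ᶜ (λ L → K-part L + X-part L)
        ≡⟨ ∑ᶜ-distrib-+ K-part X-part ⟩
      ∑ᶜ K-part + ∑ᶜ X-part
        ≡⟨ cong₂ _+_ (∑ᶜ-𝟙-≟-* K-component G) (∑ᶜ-multiplicity X-components G) ⟩
      G K + sum (map G X) ∎
      where
      open ≡-Reasoning
      K-part X-part : Component n r → ℕ
      K-part L = 𝟙 (does (K ≟ᶜ L)) * G L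
      X-part L = multiplicity X L * G L

    ∑ᶜ-complement : ∀ {X} → Unique X → All (IsComponent c) X → (G : Component n r → ℕ) →
      ∑ᶜ (λ L → (1 ∸ multiplicity X L) * G L) + sum (map G X) ≡ ∑ᶜ G
    ∑ᶜ-complement {X} X! X-components G = begin
      ∑ᶜ outside + sum (map G X)          ≡⟨ cong (∑ᶜ outside +_) (∑ᶜ-multiplicity X-components G) ⟨
      ∑ᶜ outside + ∑ᶜ inside              ≡⟨ ∑ᶜ-distrib-+ outside inside ⟨
      ∑ᶜ (λ L → outside L + inside L)     ≡⟨ ∑ᶜ-cong (λ L → outside L + inside L) G (split ∘₂ component) ⟩
      ∑ᶜ G                                ∎
      where
      open ≡-Reasoning
      outside inside : Component n r → ℕ
      outside L = (1 ∸ multiplicity X L) * G L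
      inside  L = multiplicity X L * G L
      split : ∀ L → outside L + inside L ≡ G L
      split L = begin
        (1 ∸ multiplicity X L) * G L + multiplicity X L * G L
          ≡⟨ *-distribʳ-+ (G L) (1 ∸ multiplicity X L) _ ⟨
        (1 ∸ multiplicity X L + multiplicity X L) * G L
          ≡⟨ cong (_* G L) (m∸n+n≡m (multiplicity≤1 X! L)) ⟩
        1 * G L
          ≡⟨ *-identityˡ (G L) ⟩
        G L ∎

open import Defs
open import Data.Nat using (ℕ; _≤_)
open import Data.Nat.Combinatorics using (_C_)
open import Data.List using (List; length; map)
open import Data.Nat.ListAction using (sum)
open import Data.List.Relation.Unary.All using (All)
open import Data.List.Relation.Unary.Unique.Propositional using (Unique)
open import Data.Product using (Σ; _×_; _,_)
open import Data.Rational using (ℚ; _*_; _-_; _<_; 0ℚ; 1ℚ) renaming (_≤_ to _≤ℚ_)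

import Data.Integer as ℤ
import Data.Integer.Properties as ℤ
import Data.List.Relation.Unary.All as All
import Data.Nat as ℕ
import Data.Nat.Properties as ℕ
open import Algebra.Properties.Semiring.Sum ℕ.+-*-semiring using (sum-syntax) renaming (sum to ∑)
open import Data.Empty using (⊥; ⊥-elim)
open import Data.Fin using (Fin; zero; suc)
open import Data.Fin.Properties using (any?)
open import Data.List using ([]; _∷_)
open import Data.List.Relation.Unary.All using ([]; _∷_)
open import Data.Nat.Coprimality using (Coprime)
open import Data.Nat.Divisibility using (∣1⇒≡1)
open import Data.Product using (∃₂)
open import Data.Rational using (mkℚ; _+_; -_; _/_; *≤*; *<*; NonNegative; nonNegative; positive)
open import Data.Rational.Properties
open import Data.Rational.Solver using (module +-*-Solver)
open +-*-Solver using (solve; _:=_; _:+_; _:*_; _:-_; con)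
open import Data.Sum using (_⊎_; [_,_]′)
import Data.Sum as Sum
open import Function using (_∘_)
open import Relation.Binary.PropositionalEquality
open import Relation.Nullary.Decidable.Core using (yes; no; toSum)

open Combinatorics

coprime[n,1] : ∀ n → Coprime n 1
coprime[n,1] n (_ , d∣1) = ∣1⇒≡1 d∣1

toℚ≡mkℚ : ∀ n → toℚ n ≡ mkℚ (ℤ.+ n) 0 (coprime[n,1] n)
toℚ≡mkℚ n = normalize-coprime (coprime[n,1] n)

toℚ-+ : ∀ m n → toℚ (m ℕ.+ n) ≡ toℚ m + toℚ n
toℚ-+ m n rewrite toℚ≡mkℚ m | toℚ≡mkℚ n = cong (_/ 1) (sym (trans
  (cong₂ ℤ._+_ (ℤ.*-identityʳ (ℤ.+ m)) (ℤ.*-identityʳ (ℤ.+ n))) (sym (ℤ.pos-+ m n))))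

toℚ-* : ∀ m n → toℚ (m ℕ.* n) ≡ toℚ m * toℚ n
toℚ-* m n rewrite toℚ≡mkℚ m | toℚ≡mkℚ n = cong (_/ 1) (ℤ.pos-* m n)

toℚ-mono-≤ : ∀ {m n} → m ≤ n → toℚ m ≤ℚ toℚ n
toℚ-mono-≤ {m} {n} m≤n rewrite toℚ≡mkℚ m | toℚ≡mkℚ n =
  *≤* (subst₂ ℤ._≤_ (sym (ℤ.*-identityʳ (ℤ.+ m))) (sym (ℤ.*-identityʳ (ℤ.+ n))) (ℤ.+≤+ m≤n))

toℚ-mono-< : ∀ {m n} → m ℕ.< n → toℚ m < toℚ n
toℚ-mono-< {m} {n} m<n rewrite toℚ≡mkℚ m | toℚ≡mkℚ n =
  *<* (subst₂ ℤ._<_ (sym (ℤ.*-identityʳ (ℤ.+ m))) (sym (ℤ.*-identityʳ (ℤ.+ n))) (ℤ.+<+ m<n))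

0≤toℚ : ∀ n → 0ℚ ≤ℚ toℚ n
0≤toℚ n = toℚ-mono-≤ {0} {n} ℕ.z≤n

0≤p*q : ∀ {p q} → 0ℚ ≤ℚ p → 0ℚ ≤ℚ q → 0ℚ ≤ℚ p * q
0≤p*q {p} {q} 0≤p 0≤q =
  nonNegative⁻¹ (p * q) {{nonNeg*nonNeg⇒nonNeg p {{nonNegative 0≤p}} q {{nonNegative 0≤q}}}}

p≤q⇒0≤q-p : ∀ {p q} → p ≤ℚ q → 0ℚ ≤ℚ q - p
p≤q⇒0≤q-p {p} {q} p≤q = subst (_≤ℚ q - p) (+-inverseʳ p) (+-monoˡ-≤ (- p) p≤q)

p*p≤q*q⇒p≤q : ∀ {p q} → 0ℚ ≤ℚ q → p * p ≤ℚ q * q → p ≤ℚ q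
p*p≤q*q⇒p≤q {p} {q} 0≤q pp≤qq with p ≤? q
... | yes p≤q = p≤q
... | no  p≰q = ⊥-elim (<-irrefl refl (≤-<-trans pp≤qq (≤-<-trans
      (*-monoˡ-≤-nonNeg q {{nonNegative 0≤q}} (<⇒≤ q<p))
      (*-monoˡ-<-pos p {{positive (≤-<-trans 0≤q q<p)}} q<p))))
  where
  q<p : q < p
  q<p = ≰⇒> p≰q

-- t·m·e ≤ t·√z·N·w ≤ a·N·w, proved by comparing squares.
density-bound : ∀ {z t a : ℚ} {m N e w : ℕ} → 0ℚ ≤ℚ t → 0ℚ ≤ℚ a → (t * t) * z ≤ℚ a * a →
  toℚ e ≤ℚ z * toℚ N → m ℕ.* m ℕ.* e ≤ N ℕ.* (w ℕ.* w) → (t * toℚ m) * toℚ e ≤ℚ (a * toℚ N) * toℚ w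
density-bound {z} {t} {a} {m} {N} {e} {w} 0≤t 0≤a t²z≤a² e≤zN m²e≤Nw² =
  p*p≤q*q⇒p≤q (0≤p*q (0≤p*q 0≤a (0≤toℚ N)) (0≤toℚ w)) (begin
    ((t * M) * E) * ((t * M) * E)
      ≡⟨ solve 3 (λ t M E → ((t :* M) :* E) :* ((t :* M) :* E) := (t :* t) :* ((M :* M :* E) :* E))
               refl t M E ⟩
    (t * t) * ((M * M * E) * E)
      ≤⟨ *-monoˡ-≤-nonNeg (t * t) (*-monoʳ-≤-nonNeg E m²e≤Nw²′) ⟩
    (t * t) * ((N′ * (W * W)) * E)
      ≤⟨ *-monoˡ-≤-nonNeg (t * t) (*-monoˡ-≤-nonNeg (N′ * (W * W)) e≤zN) ⟩
    (t * t) * ((N′ * (W * W)) * (z * N′))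
      ≡⟨ solve 4 (λ t z N W → (t :* t) :* ((N :* (W :* W)) :* (z :* N))
                           := ((t :* t) :* z) :* ((N :* W) :* (N :* W)))
               refl t z N′ W ⟩
    ((t * t) * z) * ((N′ * W) * (N′ * W))
      ≤⟨ *-monoʳ-≤-nonNeg ((N′ * W) * (N′ * W)) t²z≤a² ⟩
    (a * a) * ((N′ * W) * (N′ * W))
      ≡⟨ solve 3 (λ a N W → (a :* a) :* ((N :* W) :* (N :* W)) := ((a :* N) :* W) :* ((a :* N) :* W))
               refl a N′ W ⟩
    ((a * N′) * W) * ((a * N′) * W) ∎)
  where
  open ≤-Reasoning
  M E N′ W : ℚ
  M  = toℚ m
  E  = toℚ e
  N′ = toℚ N
  W  = toℚ w
  instance
    t²≥0 : NonNegative (t * t)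
    t²≥0 = nonNegative (0≤p*q 0≤t 0≤t)
    E≥0 : NonNegative E
    E≥0 = nonNegative (0≤toℚ e)
    NW²≥0 : NonNegative (N′ * (W * W))
    NW²≥0 = nonNegative (0≤p*q (0≤toℚ N) (0≤p*q (0≤toℚ w) (0≤toℚ w)))
    [NW]²≥0 : NonNegative ((N′ * W) * (N′ * W))
    [NW]²≥0 = nonNegative (0≤p*q NW≥0 NW≥0)
      where
      NW≥0 : 0ℚ ≤ℚ N′ * W
      NW≥0 = 0≤p*q (0≤toℚ N) (0≤toℚ w)
  m²e≤Nw²′ : M * M * E ≤ℚ N′ * (W * W)
  m²e≤Nw²′ = subst₂ _≤ℚ_ (trans (toℚ-* (m ℕ.* m) e) (cong (_* E) (toℚ-* m m)))
                         (trans (toℚ-* N (w ℕ.* w)) (cong (N′ *_) (toℚ-* w w)))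
                         (toℚ-mono-≤ m²e≤Nw²)

∑-scaled-≤ : ∀ {s t : ℚ} {m} (f g : Fin m → ℕ) → (∀ k → s * toℚ (f k) ≤ℚ t * toℚ (g k)) →
  s * toℚ (∑ f) ≤ℚ t * toℚ (∑ g)
∑-scaled-≤ {s} {t} {ℕ.zero}  f g _  = subst₂ _≤ℚ_ (sym (*-zeroʳ s)) (sym (*-zeroʳ t)) ≤-refl
∑-scaled-≤ {s} {t} {ℕ.suc m} f g fg = subst₂ _≤ℚ_ (sym (split s f)) (sym (split t g))
  (+-mono-≤ (fg zero) (∑-scaled-≤ {s} {t} (f ∘ suc) (g ∘ suc) (fg ∘ suc)))
  where
  split : ∀ s (h : Fin (ℕ.suc m) → ℕ) → s * toℚ (∑ h) ≡ s * toℚ (h zero) + s * toℚ (∑ (h ∘ suc))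
  split s h = trans (cong (s *_) (toℚ-+ (h zero) _)) (*-distribˡ-+ s _ _)

*-scaled-≤ : ∀ {s t : ℚ} k {x y} → s * toℚ x ≤ℚ t * toℚ y → s * toℚ (k ℕ.* x) ≤ℚ t * toℚ (k ℕ.* y)
*-scaled-≤ {s} {t} k {x} {y} sx≤ty = begin
  s * toℚ (k ℕ.* x)     ≡⟨ trans (cong (s *_) (toℚ-* k x)) (swap s (toℚ k) (toℚ x)) ⟩
  toℚ k * (s * toℚ x)   ≤⟨ *-monoˡ-≤-nonNeg (toℚ k) {{nonNegative (0≤toℚ k)}} sx≤ty ⟩
  toℚ k * (t * toℚ y)   ≡⟨ trans (cong (t *_) (toℚ-* k y)) (swap t (toℚ k) (toℚ y)) ⟨
  t * toℚ (k ℕ.* y)     ∎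
  where
  open ≤-Reasoning
  swap : ∀ s k x → s * (k * x) ≡ k * (s * x)
  swap = solve 3 (λ s k x → s :* (k :* x) := k :* (s :* x)) refl

module _ {A : Set} (f : A → ℕ) {b : ℚ} where

  private
    toℚ-sum-∷ : ∀ x X → toℚ (sum (map f (x ∷ X))) ≡ toℚ (f x) + toℚ (sum (map f X))
    toℚ-sum-∷ x X = toℚ-+ (f x) _

    length-∷-* : ∀ (x : A) X → toℚ (length (x ∷ X)) * b ≡ b + toℚ (length X) * b
    length-∷-* x X = trans (cong (_* b) (toℚ-+ 1 (length X)))
                           (solve 2 (λ L b → (con 1ℚ :+ L) :* b := b :+ L :* b) refl (toℚ (length X)) b)

  sum-map-≤ : ∀ X → All (λ x → toℚ (f x) ≤ℚ b) X → toℚ (sum (map f X)) ≤ℚ toℚ (length X) * b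
  sum-map-≤ []      []              = ≤-reflexive (sym (*-zeroˡ b))
  sum-map-≤ (x ∷ X) (fx≤b ∷ fX≤b) = subst₂ _≤ℚ_ (sym (toℚ-sum-∷ x X)) (sym (length-∷-* x X))
    (+-mono-≤ fx≤b (sum-map-≤ X fX≤b))

  sum-map-< : ∀ X → 1 ≤ length X → All (λ x → toℚ (f x) < b) X → toℚ (sum (map f X)) < toℚ (length X) * b
  sum-map-< (x ∷ X) _ (fx<b ∷ fX<b) = subst₂ _<_ (sym (toℚ-sum-∷ x X)) (sym (length-∷-* x X))
    (+-mono-<-≤ fx<b (sum-map-≤ X (All.map <⇒≤ fX<b)))

uncovered-bound : ∀ {V W r n γ : ℚ} → V + W ≡ r * n → γ * n ≤ℚ W → V ≤ℚ (r - γ) * n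
uncovered-bound {V} {W} {r} {n} {γ} V+W≡rn γn≤W = begin
  V                     ≡⟨ solve 2 (λ V g → V := (V :+ g) :- g) refl V (γ * n) ⟩
  (V + γ * n) - γ * n   ≤⟨ +-monoˡ-≤ (- (γ * n)) (+-monoʳ-≤ V γn≤W) ⟩
  (V + W) - γ * n       ≡⟨ cong (_- γ * n) V+W≡rn ⟩
  r * n - γ * n         ≡⟨ solve 3 (λ r n g → r :* n :- g :* n := (r :- g) :* n) refl r n γ ⟩
  (r - γ) * n           ∎
  where open ≤-Reasoning

-- The bound n·B ≤ N·V is only needed when t ≤ 0, where the first one says nothing about B.
complement-bound : ∀ {t a n N B V : ℚ} → 0ℚ < n → 0ℚ ≤ℚ a → 0ℚ ≤ℚ N →
  (t * n) * B ≤ℚ (a * N) * V → n * B ≤ℚ N * V → V ≤ℚ t * n → B ≤ℚ a * N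
complement-bound {t} {a} {n} {N} {B} {V} 0<n 0≤a 0≤N tnB≤aNV nB≤NV V≤tn with 0ℚ <? t
... | yes 0<t = *-cancelˡ-≤-pos (t * n) {{positive 0<tn}} (begin
  (t * n) * B         ≤⟨ tnB≤aNV ⟩
  (a * N) * V         ≤⟨ *-monoˡ-≤-nonNeg (a * N) {{nonNegative (0≤p*q 0≤a 0≤N)}} V≤tn ⟩
  (a * N) * (t * n)   ≡⟨ *-comm (a * N) (t * n) ⟩
  (t * n) * (a * N)   ∎)
  where
  open ≤-Reasoning
  0<tn : 0ℚ < t * n
  0<tn = subst (_< t * n) (*-zeroˡ n) (*-monoˡ-<-pos n {{positive 0<n}} 0<t)
... | no  0≮t = ≤-trans B≤0 (0≤p*q 0≤a 0≤N)
  where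
  open ≤-Reasoning
  V≤0 : V ≤ℚ 0ℚ
  V≤0 = ≤-trans V≤tn (subst (t * n ≤ℚ_) (*-zeroˡ n)
                            (*-monoʳ-≤-nonNeg n {{nonNegative (<⇒≤ 0<n)}} (≮⇒≥ 0≮t)))
  B≤0 : B ≤ℚ 0ℚ
  B≤0 = *-cancelˡ-≤-pos n {{positive 0<n}} (begin
    n * B    ≤⟨ nB≤NV ⟩
    N * V    ≤⟨ *-monoˡ-≤-nonNeg N {{nonNegative 0≤N}} V≤0 ⟩
    N * 0ℚ   ≡⟨ *-zeroʳ N ⟩
    0ℚ       ≡⟨ *-zeroʳ n ⟨
    n * 0ℚ   ∎)

budget-contradiction : ∀ {N E B x : ℚ} → N ≡ E + B → E < x * N → B ≤ℚ (1ℚ - x) * N → ⊥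
budget-contradiction {N} {E} {B} {x} N≡E+B E<xN B≤[1-x]N = <-irrefl refl (begin-strict
  N                      ≡⟨ N≡E+B ⟩
  E + B                  <⟨ +-mono-<-≤ E<xN B≤[1-x]N ⟩
  x * N + (1ℚ - x) * N   ≡⟨ solve 2 (λ x N → x :* N :+ (con 1ℚ :- x) :* N := N) refl x N ⟩
  N                      ∎)
  where open ≤-Reasoning

module _ {n r} (c : Coloring n r) where

  open Components c

  ∑ᶜ-scaled-≤ : ∀ {s t : ℚ} (F G : Component n r → ℕ) →
    (∀ i u → s * toℚ (F (component i u)) ≤ℚ t * toℚ (G (component i u))) →
    s * toℚ (∑ᶜ F) ≤ℚ t * toℚ (∑ᶜ G)
  ∑ᶜ-scaled-≤ {s} {t} F G FG =
    ∑-scaled-≤ {s} {t} _ _ λ i → ∑-scaled-≤ {s} {t} _ _ λ u →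
      *-scaled-≤ {s} {t} (𝟙 (leader i u)) (FG i u)

  dense-or-sparse : ∀ (b : ℚ) →
    (∃₂ λ i u → b ≤ℚ toℚ (esize c (component i u))) ⊎ (∀ i u → toℚ (esize c (component i u)) < b)
  dense-or-sparse b = Sum.map₂ (λ ¬dense i u → ≰⇒> λ b≤e → ¬dense (i , u , b≤e))
    (toSum (any? λ i → any? λ u → b ≤? toℚ (esize c (component i u))))

  sparse⇒⊥ : ∀ {z γ : ℚ} {X} → 1 ≤ n → Unique X → All (IsComponent c) X →
    γ ≤ℚ toℚ r → 1 ≤ length X →
    γ * toℚ n ≤ℚ toℚ (sum (map vsize X)) → toℚ (length X) * z ≤ℚ 1ℚ →
    ((toℚ r - γ) * (toℚ r - γ)) * z ≤ℚ (1ℚ - toℚ (length X) * z) * (1ℚ - toℚ (length X) * z) →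
    (∀ i u → toℚ (esize c (component i u)) < z * toℚ (n C 2)) → ⊥
  sparse⇒⊥ {z} {γ} {X} 1≤n X! X-components γ≤r 1≤x γn≤W xz≤1 t²z≤a² sparse =
    budget-contradiction {x = toℚ (length X) * z} edge-budget E<xzN B≤aN
    where
    N : ℕ
    N = n C 2
    t a : ℚ
    t = toℚ r - γ
    a = 1ℚ - toℚ (length X) * z
    outside : (Component n r → ℕ) → Component n r → ℕ
    outside G K = (1 ℕ.∸ multiplicity X K) ℕ.* G K
    E B V : ℚ
    E = toℚ (sum (map (esize c) X))
    B = toℚ (∑ᶜ (outside (esize c)))
    V = toℚ (∑ᶜ (outside vsize))
    budget : ∀ (G : Component n r → ℕ) → toℚ (∑ᶜ (outside G)) + toℚ (sum (map G X)) ≡ toℚ (∑ᶜ G)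
    budget G = trans (sym (toℚ-+ (∑ᶜ (outside G)) _)) (cong toℚ (∑ᶜ-complement X! X-components G))
    edge-budget : toℚ N ≡ E + B
    edge-budget = trans (cong toℚ (sym ∑ᶜ-esize)) (trans (sym (budget (esize c))) (+-comm B E))
    E<xzN : E < toℚ (length X) * z * toℚ N
    E<xzN = subst (E <_) (sym (*-assoc (toℚ (length X)) z (toℚ N)))
      (sum-map-< (esize c) X 1≤x (All.map sparse′ X-components))
      where
      sparse′ : ∀ {K} → IsComponent c K → toℚ (esize c K) < z * toℚ N
      sparse′ K-component with isComponent⇒component K-component
      ... | i , u , refl = sparse i u
    V≤tn : V ≤ℚ t * toℚ n
    V≤tn = uncovered-bound {r = toℚ r} {n = toℚ n} {γ = γ}
      (trans (budget vsize) (trans (cong toℚ ∑ᶜ-vsize) (toℚ-* r n))) γn≤W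
    tnB≤aNV : (t * toℚ n) * B ≤ℚ (a * toℚ N) * V
    tnB≤aNV = ∑ᶜ-scaled-≤ {t * toℚ n} {a * toℚ N} (outside (esize c)) (outside vsize) λ i u →
      *-scaled-≤ {t * toℚ n} {a * toℚ N} (1 ℕ.∸ multiplicity X (component i u))
        (density-bound {z} {t} {a} {n} {N} {esize c (component i u)} {vsize (component i u)}
          (p≤q⇒0≤q-p γ≤r) (p≤q⇒0≤q-p xz≤1) t²z≤a² (<⇒≤ (sparse i u))
          (n*n*esize≤nC2*vsize² c (component i u)))
    nB≤NV : toℚ n * B ≤ℚ toℚ N * V
    nB≤NV = ∑ᶜ-scaled-≤ {toℚ n} {toℚ N} (outside (esize c)) (outside vsize) λ i u →
      *-scaled-≤ {toℚ n} {toℚ N} (1 ℕ.∸ multiplicity X (component i u))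
        (subst₂ _≤ℚ_ (toℚ-* n (esize c (component i u))) (toℚ-* N (vsize (component i u)))
          (toℚ-mono-≤ (n*esize≤nC2*vsize c (component i u) 1≤n)))
    B≤aN : B ≤ℚ a * toℚ N
    B≤aN = complement-bound {t = t} {a = a} (toℚ-mono-< 1≤n) (p≤q⇒0≤q-p xz≤1) (0≤toℚ N) tnB≤aNV nB≤NV V≤tn

open Components using (component; component-isComponent)

corollary2p2 : (r n : ℕ) → 2 ≤ r → 1 ≤ n → (c : Coloring n r) →
  (z : ℚ) → 0ℚ < z →
  (X : List (Component n r)) → Unique X → All (IsComponent c) X →
  (γ : ℚ) → 0ℚ ≤ℚ γ → γ ≤ℚ toℚ r →
  1 ≤ length X →
  γ * toℚ n ≤ℚ toℚ (sum (map vsize X)) →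
  -- x ≤ 1/z - (r - γ)/√z, written without square roots (equivalent since r - γ ≥ 0, z > 0)
  toℚ (length X) * z ≤ℚ 1ℚ →
  ((toℚ r - γ) * (toℚ r - γ)) * z ≤ℚ (1ℚ - toℚ (length X) * z) * (1ℚ - toℚ (length X) * z) →
  Σ (Component n r) λ K → IsComponent c K × (z * toℚ (n C 2) ≤ℚ toℚ (esize c K))
corollary2p2 r n _ 1≤n c z _ X X! X-components γ _ γ≤r 1≤x γn≤W xz≤1 t²z≤a² =
  [ (λ (i , u , dense) → component c i u , component-isComponent c i u , dense)
  , (λ sparse → ⊥-elim (sparse⇒⊥ c 1≤n X! X-components γ≤r 1≤x γn≤W xz≤1 t²z≤a² sparse))
  ]′ (dense-or-sparse c (z * toℚ (n C 2)))
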